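{- Let $\mathbf{h}$ be a weakly increasing sequence of positive integers with $\mathbf{h}(i)>i$ for all $i$, and let $S$ be a nonempty $\mathbf{h}$-admissible set. Let $n,k$ be positive integers with $\mathbf{j}(S)\le k\le n$. If $\pi\in S_n$ satisfies $\mathrm{inv}_\mathbf{h}(\pi)=S$, then the flattening $\pi|_k\in S_k$ also satisfies $\mathrm{inv}_\mathbf{h}(\pi|_k)=S$.
   Context: $\mathcal{P}_\mathbf{h}=\{(i,j): i<j\le \mathbf{h}(i)\}$. For $\pi=\pi_1\cdots\pi_n\in S_n$ (one-line notation), $\mathrm{inv}_\mathbf{h}(\pi)=\{(i,j)\in\mathcal{P}_\mathbf{h}: j\le n,\ \pi_i>\pi_j\}$. A subset $S\subseteq\mathcal{P}_\mathbf{h}$ is $\mathbf{h}$-admissible if $S=\mathrm{inv}_\mathbf{h}(\pi)$ for some permutation $\pi$ of some $S_n$. $\mathbf{j}(S)=\max\{j:(i,j)\in S\}$. For $k\le n$, the flattening $\pi|_k\in S_k$ is the permutation obtained by listing $1,\dots,k$ in the same relative order as $\pi_1,\dots,\pi_k$. -}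

module Defs where

open import Data.Nat using (ℕ; zero; suc; _+_; _≤_; _<_)
open import Data.Nat.Properties using (_<?_)
open import Data.Fin using (Fin; toℕ; fromℕ<; inject≤)
import Data.Fin as F
open import Data.Vec using (count; allFin)
open import Data.Product using (Σ; _×_; ∃)
open import Relation.Nullary using (yes; no)
open import Relation.Binary.PropositionalEquality using (_≡_)
open import Function.Definitions using (Bijective)
open import Function.Bundles using (_⇔_)

-- A permutation in S_n, in one-line notation: position a (0-based Fin index,
-- i.e. position toℕ a + 1) holds the value π a (value toℕ (π a) + 1).
IsPerm : ∀ {n} → (Fin n → Fin n) → Set
IsPerm π = Bijective _≡_ _≡_ π

WeaklyIncreasing : (ℕ → ℕ) → Set
WeaklyIncreasing h = ∀ i j → 1 ≤ i → i ≤ j → h i ≤ h j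

Exceeds : (ℕ → ℕ) → Set
Exceeds h = ∀ i → 1 ≤ i → i < h i

InPh : (ℕ → ℕ) → ℕ → ℕ → Set
InPh h i j = 1 ≤ i × i < j × j ≤ h i

Inv : (ℕ → ℕ) → ∀ {n} → (Fin n → Fin n) → ℕ → ℕ → Set
Inv h {n} π i j =
  InPh h i j × Σ (Fin n) λ a → Σ (Fin n) λ b →
    (toℕ a + 1 ≡ i) × (toℕ b + 1 ≡ j) × (π b F.< π a)

SameSet : (ℕ → ℕ → Set) → (ℕ → ℕ → Set) → Set
SameSet S T = ∀ i j → S i j ⇔ T i j

Admissible : (ℕ → ℕ) → (ℕ → ℕ → Set) → Set
Admissible h S = Σ ℕ λ m → Σ (Fin m → Fin m) λ σ → IsPerm σ × SameSet S (Inv h σ)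

NonEmpty : (ℕ → ℕ → Set) → Set
NonEmpty S = Σ ℕ λ i → Σ ℕ λ j → S i j

-- j(S) ≤ k, i.e. max{ j : (i,j) ∈ S } ≤ k  (for nonempty S)
JLe : (ℕ → ℕ → Set) → ℕ → Set
JLe S k = ∀ i j → S i j → j ≤ k

rank : ∀ {n k} → (Fin n → Fin n) → k ≤ n → Fin k → ℕ
rank {k = k} π k≤n a =
  count (λ b → toℕ (π (inject≤ b k≤n)) <? toℕ (π (inject≤ a k≤n))) (allFin k)

-- flattening π|_k : position a receives its rank among the first k values.
-- (the fallback branch never occurs for an injective π since rank < k)
flatten : ∀ {n k} → (Fin n → Fin n) → k ≤ n → Fin k → Fin k
flatten {k = k} π k≤n a with rank π k≤n a <? k
... | yes p = fromℕ< p
... | no _  = a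

{-# OPTIONS --safe #-}
module Submission where

-- The flattening sends a position a ≤ k to the rank of π a among π 1, …, π k,
-- and the rank is strictly monotone in the value, so on positions ≤ k the
-- flattening inverts exactly the pairs that π inverts. Every pair of
-- S = inv_h(π) lies in positions ≤ j(S) ≤ k, hence inv_h(π|_k) = S. Only
-- j(S) ≤ k is needed: the rank counts strictly smaller values only, so it is
-- below k even when π is not injective.

open import Defs
open import Level using (0ℓ)
open import Data.Nat using (ℕ; suc; _≤_; _<_; _+_; z≤n; s≤s; s≤s⁻¹)
open import Data.Nat.Properties
  using (_<?_; m≤n⇒m≤1+n; <-irrefl; <-trans; <-≤-trans; <⇒≱; ≮⇒≥; +-comm; +-cancelʳ-<)
open import Data.Fin using (Fin; toℕ; inject≤; lower)
import Data.Fin as F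
open import Data.Fin.Properties using (toℕ-fromℕ<; toℕ-inject≤; toℕ-injective)
open import Data.Vec using (Vec; []; _∷_; count; allFin)
open import Data.Vec.Properties using (count≤n)
open import Data.Vec.Relation.Unary.Any using (here; there)
open import Data.Vec.Membership.Propositional using (_∈_)
open import Data.Vec.Membership.Propositional.Properties using (∈-allFin⁺)
open import Data.Product using (_,_)
open import Data.Empty using (⊥-elim)
open import Relation.Nullary using (yes; no; ¬_)
open import Relation.Unary using (Pred; Decidable; _⊆_)
open import Relation.Binary.PropositionalEquality using (_≡_; refl; sym; trans; cong; subst; subst₂)
open import Function.Bundles using (_⇔_; mk⇔; Equivalence)

module _ {A : Set} {P : Pred A 0ℓ} (P? : Decidable P) where

  count<n : ∀ {m} {xs : Vec A m} {y} → y ∈ xs → ¬ P y → count P? xs < m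
  count<n {xs = x ∷ xs} (here refl) ¬py with P? x
  ... | yes px = ⊥-elim (¬py px)
  ... | no _   = s≤s (count≤n P? xs)
  count<n {xs = x ∷ xs} (there y∈xs) ¬py with P? x
  ... | yes _ = s≤s (count<n y∈xs ¬py)
  ... | no _  = m≤n⇒m≤1+n (count<n y∈xs ¬py)

  module _ {Q : Pred A 0ℓ} (Q? : Decidable Q) (P⊆Q : P ⊆ Q) where

    count-mono : ∀ {m} (xs : Vec A m) → count P? xs ≤ count Q? xs
    count-mono []       = z≤n
    count-mono (x ∷ xs) with P? x | Q? x
    ... | yes _  | yes _  = s≤s (count-mono xs)
    ... | yes px | no ¬qx = ⊥-elim (¬qx (P⊆Q px))
    ... | no _   | yes _  = m≤n⇒m≤1+n (count-mono xs)
    ... | no _   | no _   = count-mono xs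

    count-mono-< : ∀ {m} {xs : Vec A m} {y} → y ∈ xs → ¬ P y → Q y →
                   count P? xs < count Q? xs
    count-mono-< {xs = x ∷ xs} (here refl) ¬py qy with P? x | Q? x
    ... | yes px | _      = ⊥-elim (¬py px)
    ... | no _   | yes _  = s≤s (count-mono xs)
    ... | no _   | no ¬qy = ⊥-elim (¬qy qy)
    count-mono-< {xs = x ∷ xs} (there y∈xs) ¬py qy with P? x | Q? x
    ... | yes _  | yes _  = s≤s (count-mono-< y∈xs ¬py qy)
    ... | yes px | no ¬qx = ⊥-elim (¬qx (P⊆Q px))
    ... | no _   | yes _  = m≤n⇒m≤1+n (count-mono-< y∈xs ¬py qy)
    ... | no _   | no _   = count-mono-< y∈xs ¬py qy

toℕ-lower : ∀ {n k} (a : Fin n) .(a<k : toℕ a < k) → toℕ (lower a a<k) ≡ toℕ a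
toℕ-lower {k = suc _} F.zero    _   = refl
toℕ-lower {k = suc _} (F.suc a) a<k = cong suc (toℕ-lower a (s≤s⁻¹ a<k))

inject≤-lower : ∀ {n k} (a : Fin n) .(a<k : toℕ a < k) (k≤n : k ≤ n) →
                inject≤ (lower a a<k) k≤n ≡ a
inject≤-lower a a<k k≤n =
  toℕ-injective (trans (toℕ-inject≤ (lower a a<k) k≤n) (toℕ-lower a a<k))

module _ {n k} (π : Fin n → Fin n) (k≤n : k ≤ n) where

  value : Fin k → ℕ
  value a = toℕ (π (inject≤ a k≤n))

  rank<k : ∀ a → rank π k≤n a < k
  rank<k a = count<n (λ b → value b <? value a) (∈-allFin⁺ a) (<-irrefl refl)

  toℕ-flatten : ∀ a → toℕ (flatten π k≤n a) ≡ rank π k≤n a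
  toℕ-flatten a with rank π k≤n a <? k
  ... | yes r<k = toℕ-fromℕ< r<k
  ... | no r≮k  = ⊥-elim (r≮k (rank<k a))

  rank-mono : ∀ {a b} → value a ≤ value b → rank π k≤n a ≤ rank π k≤n b
  rank-mono {a} {b} a≤b =
    count-mono (λ c → value c <? value a) (λ c → value c <? value b)
      (λ c<a → <-≤-trans c<a a≤b) (allFin k)

  rank-mono-< : ∀ {a b} → value a < value b → rank π k≤n a < rank π k≤n b
  rank-mono-< {a} {b} a<b =
    count-mono-< (λ c → value c <? value a) (λ c → value c <? value b)
      (λ c<a → <-trans c<a a<b) (∈-allFin⁺ a) (<-irrefl refl) a<b

  flatten-<⇔ : ∀ {a b} → flatten π k≤n a F.< flatten π k≤n b ⇔ value a < value b
  flatten-<⇔ {a} {b} = mk⇔ to from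
    where
    to : flatten π k≤n a F.< flatten π k≤n b → value a < value b
    to fa<fb with value a <? value b
    ... | yes a<b = a<b
    ... | no a≮b  = ⊥-elim (<⇒≱ (subst₂ _<_ (toℕ-flatten a) (toℕ-flatten b) fa<fb)
                                 (rank-mono (≮⇒≥ a≮b)))
    from : value a < value b → flatten π k≤n a F.< flatten π k≤n b
    from a<b = subst₂ _<_ (sym (toℕ-flatten a)) (sym (toℕ-flatten b)) (rank-mono-< a<b)

module _ (h : ℕ → ℕ) {n k} (π : Fin n → Fin n) (k≤n : k ≤ n) where

  Inv-flatten⁻ : ∀ {i j} → Inv h (flatten π k≤n) i j → Inv h π i j
  Inv-flatten⁻ (ph , a , b , refl , refl , fb<fa) =
    ph , inject≤ a k≤n , inject≤ b k≤n ,
    cong (_+ 1) (toℕ-inject≤ a k≤n) , cong (_+ 1) (toℕ-inject≤ b k≤n) ,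
    Equivalence.to (flatten-<⇔ π k≤n) fb<fa

  Inv-flatten⁺ : ∀ {i j} → j ≤ k → Inv h π i j → Inv h (flatten π k≤n) i j
  Inv-flatten⁺ j≤k (ph@(_ , i<j , _) , a , b , refl , refl , πb<πa) =
    ph , lower a a<k , lower b b<k ,
    cong (_+ 1) (toℕ-lower a a<k) , cong (_+ 1) (toℕ-lower b b<k) ,
    Equivalence.from (flatten-<⇔ π k≤n)
      (subst₂ (λ x y → π x F.< π y)
              (sym (inject≤-lower b b<k k≤n)) (sym (inject≤-lower a a<k k≤n)) πb<πa)
    where
    b<k : toℕ b < k
    b<k = subst (_≤ k) (+-comm (toℕ b) 1) j≤k
    a<k : toℕ a < k
    a<k = <-trans (+-cancelʳ-< 1 (toℕ a) (toℕ b) i<j) b<k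

lemma2p7 : (h : ℕ → ℕ) → WeaklyIncreasing h → Exceeds h →
           (S : ℕ → ℕ → Set) → NonEmpty S → Admissible h S →
           (n k : ℕ) → 1 ≤ k → (k≤n : k ≤ n) → JLe S k →
           (π : Fin n → Fin n) → IsPerm π → SameSet S (Inv h π) →
           SameSet S (Inv h (flatten π k≤n))
lemma2p7 h _ _ _ _ _ _ _ _ k≤n j[S]≤k π _ S≡inv i j = mk⇔
  (λ s → Inv-flatten⁺ h π k≤n (j[S]≤k i j s) (Equivalence.to (S≡inv i j) s))
  (λ inv → Equivalence.from (S≡inv i j) (Inv-flatten⁻ h π k≤n inv))
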